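{- Let $w$ be a binary word over $\{0,1\}$, $a\in\{0,1\}$ and $3\le i\le|w|+3$. Then (i) $\mathrm{Left}_i(\mathrm{RC}(w))=\mathrm{RC}(\mathrm{pref}_{i-3}(w))$; (ii) $\mathrm{Right}_i(\mathrm{RC}(w))=\mathrm{RC}(\mathrm{suff}_{i-3}(w))$; (iii) $|\mathrm{RC}(w)|=|w|+3$; (iv) $\ell(\mathrm{RC}(wa))=\ell(\mathrm{RC}(w))+a$; (v) $\ell(\mathrm{RC}(w))=|w|_1+2$; (vi) $\ell(\mathrm{Left}_i(\mathrm{RC}(w)))=|\mathrm{pref}_{i-3}(w)|_1+2$; (vii) $\ell(\mathrm{Right}_i(\mathrm{RC}(w)))=|\mathrm{suff}_{i-3}(w)|_1+2$.
   Context: A caterpillar sequence is a finite sequence $S=(s_1,\dots,s_k)$, $k\ge1$, of non-negative integers with $s_1,s_k\ge1$, and $s_1\ge2$ if $k=1$; its size is $|S|=k+\sum_j s_j$ and its number of leaves is $\ell(S)=\sum_j s_j$. The reading caterpillar sequence: $\mathrm{RC}(\varepsilon)=(2)$ and, if $\mathrm{RC}(u)=(r_1,\dots,r_k)$, $\mathrm{RC}(u0)=(r_1,\dots,r_{k-1},r_k-1,1)$, $\mathrm{RC}(u1)=(r_1,\dots,r_{k-1},r_k+1)$. For $3\le i\le|S|$: $\mathrm{Left}_i(S)=S$ if $i=|S|$; $\mathrm{Left}_i(S)=\mathrm{Left}_i(s_1,\dots,s_{k-1},s_k-1)$ if $i<|S|$, $s_k\ge2$; $\mathrm{Left}_i(S)=\mathrm{Left}_i(s_1,\dots,s_{k-2},s_{k-1}+1)$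 if $i<|S|$, $s_k=1$. Symmetrically, $\mathrm{Right}_i(S)=S$ if $i=|S|$; $\mathrm{Right}_i(S)=\mathrm{Right}_i(s_1-1,s_2,\dots,s_k)$ if $i<|S|$, $s_1\ge2$; $\mathrm{Right}_i(S)=\mathrm{Right}_i(s_2+1,s_3,\dots,s_k)$ if $i<|S|$, $s_1=1$. $\mathrm{pref}_j(w)$ and $\mathrm{suff}_j(w)$ are the prefix and suffix of $w$ of length $j$, and $|x|_1$ is the number of $1$'s in $x$. -}

module Defs where

open import Data.Nat using (ℕ; zero; suc; _+_; _∸_)
open import Data.Bool using (Bool; true; false; if_then_else_)
open import Data.List using (List; []; _∷_; length; map; foldl; take; drop)
open import Data.Nat.ListAction using (sum)
open import Function using (_∘_)

-- Binary words over {0,1}: false = 0, true = 1.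
Word : Set
Word = List Bool

bit : Bool → ℕ
bit false = 0
bit true  = 1

ones : Word → ℕ
ones w = sum (map bit w)

pref : ℕ → Word → Word
pref j w = take j w

suff : ℕ → Word → Word
suff j w = drop (length w ∸ j) w

-- caterpillar sequences are represented as lists (s_1, ..., s_k)
Seq : Set
Seq = List ℕ

size : Seq → ℕ
size S = length S + sum S

leaves : Seq → ℕ
leaves S = sum S

appendZero : Seq → Seq
appendZero []           = []
appendZero (x ∷ [])     = x ∸ 1 ∷ 1 ∷ []
appendZero (x ∷ y ∷ r)  = x ∷ appendZero (y ∷ r)

appendOne : Seq → Seq
appendOne []          = []
appendOne (x ∷ [])    = suc x ∷ []
appendOne (x ∷ y ∷ r) = x ∷ appendOne (y ∷ r)

rcStep : Seq → Bool → Seq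
rcStep S false = appendZero S
rcStep S true  = appendOne S

RC : Word → Seq
RC w = foldl rcStep (2 ∷ []) w

leftStep : Seq → Seq
leftStep []                    = []
leftStep (x ∷ [])              = x ∸ 1 ∷ []
leftStep (x ∷ suc zero ∷ [])   = suc x ∷ []
leftStep (x ∷ y ∷ [])          = x ∷ y ∸ 1 ∷ []
leftStep (x ∷ y ∷ z ∷ r)       = x ∷ leftStep (y ∷ z ∷ r)

rightStep : Seq → Seq
rightStep []                 = []
rightStep (suc zero ∷ y ∷ r) = suc y ∷ r
rightStep (x ∷ r)            = x ∸ 1 ∷ r

iter : {A : Set} → ℕ → (A → A) → A → A
iter zero    f a = a
iter (suc n) f a = f (iter n f a)

-- Each step decreases the size by exactly one, so the recursion
-- Left_i(S) stops after |S| - i steps (for 3 ≤ i ≤ |S|).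
Left : ℕ → Seq → Seq
Left i S = iter (size S ∸ i) leftStep S

Right : ℕ → Seq → Seq
Right i S = iter (size S ∸ i) rightStep S

-- A reading step RC(u) ↦ RC(ua) only changes the last entry of the sequence,
-- and it increases the size by one and the number of leaves by a; this gives
-- (iii)–(v). As long as the last entry is positive, one step of the Left
-- recursion undoes a reading step, so Left removes letters from the end of w.
-- One step of the Right recursion only touches the first entries and commutes
-- with reading steps, and it turns the initial sequence RC(a) into RC(ε) = (2);
-- hence it maps RC(aw) to RC(w), so Right removes letters from the front of w.
-- Both recursions run |RC(w)| − i = |w| − (i − 3) steps.
module Submission where

open import Defs
open import Data.Nat using (ℕ; zero; suc; _+_; _∸_; _≤_; s≤s)
open import Data.Nat.Properties using (+-comm; +-suc; +-assoc; m∸n≤m; [m+n]∸[m+o]≡n∸o; +-commutativeSemigroup)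
open import Data.Bool using (Bool; true; false)
open import Data.List using ([]; _∷_; _++_; length; map; foldl; take; drop)
open import Data.List.Properties using (foldl-++; foldl-∷ʳ; length-drop; take++drop≡id)
open import Data.Nat.ListAction using (sum)
open import Algebra.Properties.CommutativeSemigroup +-commutativeSemigroup using (x∙yz≈y∙xz)
open import Data.Product using (_×_; _,_)
open import Relation.Binary.PropositionalEquality using (_≡_; refl; sym; trans; cong; cong₂; module ≡-Reasoning)

private variable
  S T : Seq

data LastPositive : Seq → Set where
  last : ∀ {x} → LastPositive (suc x ∷ [])
  _∷_  : ∀ x → LastPositive T → LastPositive (x ∷ T)

rcStep-∷ : ∀ x a → LastPositive T → rcStep (x ∷ T) a ≡ x ∷ rcStep T a
rcStep-∷ x false last    = refl
rcStep-∷ x true  last    = refl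
rcStep-∷ x false (y ∷ p) = refl
rcStep-∷ x true  (y ∷ p) = refl

rcStep-LastPositive : ∀ a → LastPositive S → LastPositive (rcStep S a)
rcStep-LastPositive false last = _ ∷ last
rcStep-LastPositive true  last = last
rcStep-LastPositive a (x ∷ p) rewrite rcStep-∷ x a p = x ∷ rcStep-LastPositive a p

RC-LastPositive : ∀ w → LastPositive (RC w)
RC-LastPositive w = go w last
  where
  go : ∀ v → LastPositive S → LastPositive (foldl rcStep S v)
  go []      p = p
  go (a ∷ v) p = go v (rcStep-LastPositive a p)

sum-rcStep : ∀ a → LastPositive S → sum (rcStep S a) ≡ bit a + sum S
sum-rcStep false (last {x}) = +-suc x 0
sum-rcStep true  last       = refl
sum-rcStep {S = x ∷ T} a (x ∷ p) = begin
  sum (rcStep (x ∷ T) a) ≡⟨ cong sum (rcStep-∷ x a p) ⟩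
  x + sum (rcStep T a)   ≡⟨ cong (x +_) (sum-rcStep a p) ⟩
  x + (bit a + sum T)    ≡⟨ x∙yz≈y∙xz x (bit a) (sum T) ⟩
  bit a + (x + sum T)    ∎
  where open ≡-Reasoning

length-appendZero : LastPositive S → length (appendZero S) ≡ suc (length S)
length-appendZero last    = refl
length-appendZero (x ∷ p) rewrite rcStep-∷ x false p = cong suc (length-appendZero p)

length-appendOne : ∀ S → length (appendOne S) ≡ length S
length-appendOne []          = refl
length-appendOne (x ∷ [])    = refl
length-appendOne (x ∷ y ∷ S) = cong suc (length-appendOne (y ∷ S))

size-rcStep : ∀ a → LastPositive S → size (rcStep S a) ≡ suc (size S)
size-rcStep false p rewrite length-appendZero p | sum-rcStep false p = refl
size-rcStep {S} true p rewrite length-appendOne S | sum-rcStep true p = +-suc (length S) (sum S)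

foldl-rcStep-additive : (μ : Seq → ℕ) (c : Bool → ℕ) →
  (∀ a {S} → LastPositive S → μ (rcStep S a) ≡ c a + μ S) →
  ∀ v → LastPositive S → μ (foldl rcStep S v) ≡ sum (map c v) + μ S
foldl-rcStep-additive μ c step []      p = refl
foldl-rcStep-additive {S} μ c step (a ∷ v) p = begin
  μ (foldl rcStep (rcStep S a) v)  ≡⟨ foldl-rcStep-additive μ c step v (rcStep-LastPositive a p) ⟩
  sum (map c v) + μ (rcStep S a)   ≡⟨ cong (sum (map c v) +_) (step a p) ⟩
  sum (map c v) + (c a + μ S)      ≡⟨ sym (+-assoc (sum (map c v)) (c a) (μ S)) ⟩
  sum (map c v) + c a + μ S        ≡⟨ cong (_+ μ S) (+-comm (sum (map c v)) (c a)) ⟩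
  c a + sum (map c v) + μ S        ∎
  where open ≡-Reasoning

size-RC : ∀ w → size (RC w) ≡ length w + 3
size-RC w = trans (foldl-rcStep-additive size (λ _ → 1) (λ a → size-rcStep a) w last)
                  (cong (_+ 3) (count-length w))
  where
  count-length : ∀ v → sum (map (λ _ → 1) v) ≡ length v
  count-length []      = refl
  count-length (_ ∷ v) = cong suc (count-length v)

leaves-RC : ∀ w → leaves (RC w) ≡ ones w + 2
leaves-RC w = foldl-rcStep-additive sum bit (λ a → sum-rcStep a) w last

leftStep-∷ : ∀ x y → LastPositive T → leftStep (x ∷ y ∷ T) ≡ x ∷ leftStep (y ∷ T)
leftStep-∷ {T = []}    x y             ()
leftStep-∷ {T = _ ∷ _} x zero          _ = refl
leftStep-∷ {T = _ ∷ _} x (suc zero)    _ = refl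
leftStep-∷ {T = _ ∷ _} x (suc (suc y)) _ = refl

leftStep-rcStep : ∀ a → LastPositive S → leftStep (rcStep S a) ≡ S
leftStep-rcStep false last           = refl
leftStep-rcStep true  last           = refl
leftStep-rcStep false (x ∷ last)     = leftStep-∷ x _ last
leftStep-rcStep true  (x ∷ last)     = refl
leftStep-rcStep {S = x ∷ y ∷ T} a (x ∷ y ∷ p) = begin
  leftStep (rcStep (x ∷ y ∷ T) a)   ≡⟨ cong leftStep (rcStep-∷ x a (y ∷ p)) ⟩
  leftStep (x ∷ rcStep (y ∷ T) a)   ≡⟨ cong (λ U → leftStep (x ∷ U)) (rcStep-∷ y a p) ⟩
  leftStep (x ∷ y ∷ rcStep T a)     ≡⟨ leftStep-∷ x y (rcStep-LastPositive a p) ⟩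
  x ∷ leftStep (y ∷ rcStep T a)     ≡⟨ cong (λ U → x ∷ leftStep U) (sym (rcStep-∷ y a p)) ⟩
  x ∷ leftStep (rcStep (y ∷ T) a)   ≡⟨ cong (x ∷_) (leftStep-rcStep a (y ∷ p)) ⟩
  x ∷ y ∷ T                         ∎
  where open ≡-Reasoning

leftStep-undoes-foldl : LastPositive S → ∀ v → iter (length v) leftStep (foldl rcStep S v) ≡ S
leftStep-undoes-foldl p []      = refl
leftStep-undoes-foldl p (a ∷ v) =
  trans (cong leftStep (leftStep-undoes-foldl (rcStep-LastPositive a p) v)) (leftStep-rcStep a p)

iter-leftStep-RC : ∀ j w → iter (length w ∸ j) leftStep (RC w) ≡ RC (take j w)
iter-leftStep-RC j w = begin
  iter (length w ∸ j) leftStep (RC w)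
    ≡⟨ cong₂ (λ n u → iter n leftStep (RC u)) (sym (length-drop j w)) (sym (take++drop≡id j w)) ⟩
  iter (length (drop j w)) leftStep (RC (take j w ++ drop j w))
    ≡⟨ cong (iter (length (drop j w)) leftStep) (foldl-++ rcStep (2 ∷ []) (take j w) (drop j w)) ⟩
  iter (length (drop j w)) leftStep (foldl rcStep (RC (take j w)) (drop j w))
    ≡⟨ leftStep-undoes-foldl (RC-LastPositive (take j w)) (drop j w) ⟩
  RC (take j w) ∎
  where open ≡-Reasoning

-- Sequences on which rightStep reads no entry that a reading step may change.
data HeadDetached : Seq → Set where
  single : ∀ n → HeadDetached (suc (suc (suc n)) ∷ [])
  _∷_    : ∀ x → LastPositive T → HeadDetached (x ∷ T)

rcStep-HeadDetached : ∀ a → HeadDetached S → HeadDetached (rcStep S a)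
rcStep-HeadDetached false (single n) = _ ∷ last
rcStep-HeadDetached true  (single n) = single (suc n)
rcStep-HeadDetached a (x ∷ p) rewrite rcStep-∷ x a p = x ∷ rcStep-LastPositive a p

rightStep-rcStep : ∀ a → HeadDetached S → rightStep (rcStep S a) ≡ rcStep (rightStep S) a
rightStep-rcStep false (single n) = refl
rightStep-rcStep true  (single n) = refl
rightStep-rcStep a (zero ∷ p) =
  trans (cong rightStep (rcStep-∷ zero a p)) (sym (rcStep-∷ zero a p))
rightStep-rcStep a (suc (suc x) ∷ p) =
  trans (cong rightStep (rcStep-∷ (suc (suc x)) a p)) (sym (rcStep-∷ (suc x) a p))
rightStep-rcStep false (suc zero ∷ last) = refl
rightStep-rcStep true  (suc zero ∷ last) = refl
rightStep-rcStep a (suc zero ∷ y ∷ p) =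
  trans (cong rightStep (trans (rcStep-∷ 1 a (y ∷ p)) (cong (1 ∷_) (rcStep-∷ y a p))))
        (sym (rcStep-∷ (suc y) a p))

rightStep-foldl : HeadDetached S → ∀ v → rightStep (foldl rcStep S v) ≡ foldl rcStep (rightStep S) v
rightStep-foldl h []      = refl
rightStep-foldl h (a ∷ v) =
  trans (rightStep-foldl (rcStep-HeadDetached a h) v)
        (cong (λ U → foldl rcStep U v) (rightStep-rcStep a h))

rightStep-RC-∷ : ∀ a w → rightStep (RC (a ∷ w)) ≡ RC w
rightStep-RC-∷ false w = rightStep-foldl (1 ∷ last) w
rightStep-RC-∷ true  w = rightStep-foldl (single 0) w

iter-suc : ∀ {A : Set} n (f : A → A) x → iter (suc n) f x ≡ iter n f (f x)
iter-suc zero    f x = refl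
iter-suc (suc n) f x = cong f (iter-suc n f x)

iter-rightStep-RC : ∀ m w → m ≤ length w → iter m rightStep (RC w) ≡ RC (drop m w)
iter-rightStep-RC zero    w       _        = refl
iter-rightStep-RC (suc m) (a ∷ w) (s≤s m≤) = begin
  iter (suc m) rightStep (RC (a ∷ w))       ≡⟨ iter-suc m rightStep (RC (a ∷ w)) ⟩
  iter m rightStep (rightStep (RC (a ∷ w))) ≡⟨ cong (iter m rightStep) (rightStep-RC-∷ a w) ⟩
  iter m rightStep (RC w)                   ≡⟨ iter-rightStep-RC m w m≤ ⟩
  RC (drop m w)                             ∎
  where open ≡-Reasoning

leaves-RC-∷ʳ : ∀ w a → leaves (RC (w ++ a ∷ [])) ≡ leaves (RC w) + bit a
leaves-RC-∷ʳ w a = begin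
  sum (RC (w ++ a ∷ []))     ≡⟨ cong sum (foldl-∷ʳ rcStep (2 ∷ []) a w) ⟩
  sum (rcStep (RC w) a)      ≡⟨ sum-rcStep a (RC-LastPositive w) ⟩
  bit a + sum (RC w)         ≡⟨ +-comm (bit a) (sum (RC w)) ⟩
  sum (RC w) + bit a         ∎
  where open ≡-Reasoning

size-RC-∸ : ∀ j w → size (RC w) ∸ (3 + j) ≡ length w ∸ j
size-RC-∸ j w = trans (cong (_∸ (3 + j)) (trans (size-RC w) (+-comm (length w) 3)))
                      ([m+n]∸[m+o]≡n∸o 3 (length w) j)

lemma7 : (w : Word) (a : Bool) (i : ℕ) → 3 ≤ i → i ≤ length w + 3 →
    (Left i (RC w) ≡ RC (pref (i ∸ 3) w))
    × (Right i (RC w) ≡ RC (suff (i ∸ 3) w))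
    × (size (RC w) ≡ length w + 3)
    × (leaves (RC (w ++ a ∷ [])) ≡ leaves (RC w) + bit a)
    × (leaves (RC w) ≡ ones w + 2)
    × (leaves (Left i (RC w)) ≡ ones (pref (i ∸ 3) w) + 2)
    × (leaves (Right i (RC w)) ≡ ones (suff (i ∸ 3) w) + 2)
lemma7 w a (suc (suc (suc j))) (s≤s (s≤s (s≤s _))) _ =
  left , right , size-RC w , leaves-RC-∷ʳ w a , leaves-RC w ,
  trans (cong leaves left) (leaves-RC (take j w)) ,
  trans (cong leaves right) (leaves-RC (drop (length w ∸ j) w))
  where
  left : Left (3 + j) (RC w) ≡ RC (take j w)
  left = trans (cong (λ n → iter n leftStep (RC w)) (size-RC-∸ j w)) (iter-leftStep-RC j w)

  right : Right (3 + j) (RC w) ≡ RC (drop (length w ∸ j) w)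
  right = trans (cong (λ n → iter n rightStep (RC w)) (size-RC-∸ j w))
                (iter-rightStep-RC (length w ∸ j) w (m∸n≤m (length w) j))
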